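{- Let $P$ be a finite poset that is 2-wide, parity-graded with parity rank function $\mu$, and downward Eulerian. Let $a,b\in P$. Then: (1) $\sum_{C\in \mathcal{C}_b(b)}(-1)^{|C|}=(-1)^{\mu(b)}$; (2) if $a\prec b$, then $\sum_{C\in\mathcal{C}_b(\lnot a, b)}(-1)^{|C|}=0$; (3) if $a\prec b$, then $\sum_{C\in\mathcal{C}_b(a)}(-1)^{|C|}=0$.
   Context: For $a,b$ in a poset $P$, $a\prec b$ means $b$ covers $a$. For a nonempty chain $C$, $|C|$ denotes its length, one less than its number of elements. Let $P_{<b}=\{x\in P:x<b\}$ and $P_{\le b}=\{x\in P:x\le b\}$. For $s,t\preccurlyeq b$ (where $\preccurlyeq$ means $\prec$ or $=$): $\mathcal{C}_b(s)$ is the set of nonempty chains in $P_{\le b}$ containing $s$; $\mathcal{C}_b(\lnot s,t)$ is the set of nonempty chains in $P_{\le b}$ that contain $t$ but not $s$. The order complex $\Delta(Q)$ is the simplicial complex whose simplices are the nonempty chains of $Q$; $\chi$ is Euler characteristic. $P$ is 2-wide if whenever $x\prec y\prec z$ there is $d\neq y$ with $x\prec d\prec z$. A function $\mu\colon P\to\{0,1\}$ is a parity rank function if $\mu(x)=0$ for every minimal $x$ and $\mu(y)=1-\mu(x)$ whenever $x\prec y$; $P$ is parity-graded if it has one. $P$ is downward Eulerian if for every non-minimal $x\in P$, $\chi(\Delta(P_{<x}))=(-1)^{\mu(x)+1}+1$. -}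

module Defs where

open import Level using (0ℓ)
open import Data.Nat using (ℕ; zero; suc; _∸_)
open import Data.Bool using (Bool; true; false)
open import Data.Fin using (Fin; toℕ)
open import Data.Fin.Properties using (all?)
open import Data.Fin.Subset using (Subset; _∈_; _∉_; Nonempty; ∣_∣)
open import Data.Fin.Subset.Properties using (_∈?_; nonempty?)
open import Data.Vec using ([]; _∷_)
open import Data.List using (List; []; _∷_; map; filter; foldr; _++_)
open import Data.Integer using (ℤ; _+_; -_; +_)
open import Data.Product using (Σ; ∃; _×_; _,_)
open import Data.Sum using (_⊎_)
open import Relation.Nullary using (¬_; Dec)
open import Relation.Nullary.Decidable using (_×-dec_; _⊎-dec_; _→-dec_; ¬?)
open import Relation.Unary using (Pred; Decidable)
open import Relation.Binary.PropositionalEquality using (_≡_; _≢_)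
open import Relation.Binary.Structures using (IsDecPartialOrder)

record FinPoset : Set₁ where
  field
    size : ℕ
    _≤_ : Fin size → Fin size → Set
    isDecPartialOrder : IsDecPartialOrder _≡_ _≤_
  open IsDecPartialOrder isDecPartialOrder public using (_≤?_)

allSubsets : (n : ℕ) → List (Subset n)
allSubsets zero = [] ∷ []
allSubsets (suc n) = map (true ∷_) (allSubsets n) ++ map (false ∷_) (allSubsets n)

sgn : ℕ → ℤ
sgn zero = + 1
sgn (suc k) = - sgn k

sumℤ : List ℤ → ℤ
sumℤ = foldr _+_ (+ 0)

module _ (P : FinPoset) where
  open FinPoset P

  Elt : Set
  Elt = Fin size

  _<_ : Elt → Elt → Set
  x < y = x ≤ y × x ≢ y

  _≺_ : Elt → Elt → Set
  a ≺ b = a < b × (∀ c → ¬ (a < c × c < b))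

  IsChainIn : Pred Elt 0ℓ → Subset size → Set
  IsChainIn Q C = Nonempty C × (∀ x → x ∈ C → Q x)
                  × (∀ x y → x ∈ C → y ∈ C → x ≤ y ⊎ y ≤ x)

  isChainIn? : (Q : Pred Elt 0ℓ) → Decidable Q → Decidable (IsChainIn Q)
  isChainIn? Q Q? C =
    nonempty? C
    ×-dec all? (λ x → (x ∈? C) →-dec Q? x)
    ×-dec all? (λ x → all? (λ y → (x ∈? C) →-dec (y ∈? C) →-dec ((x ≤? y) ⊎-dec (y ≤? x))))

  chainLength : Subset size → ℕ
  chainLength C = ∣ C ∣ ∸ 1

  signedSum : {R : Pred (Subset size) 0ℓ} → Decidable R → ℤ
  signedSum R? = sumℤ (map (λ C → sgn (chainLength C)) (filter R? (allSubsets size)))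

  P≤ : Elt → Pred Elt 0ℓ
  P≤ b x = x ≤ b

  P< : Elt → Pred Elt 0ℓ
  P< b x = x < b

  P<? : (b : Elt) → Decidable (P< b)
  P<? b x = (x ≤? b) ×-dec ¬? (Data.Fin.Properties._≟_ x b)

  𝒞 : Elt → Elt → Pred (Subset size) 0ℓ
  𝒞 b s C = IsChainIn (P≤ b) C × s ∈ C

  𝒞? : (b s : Elt) → Decidable (𝒞 b s)
  𝒞? b s C = isChainIn? (P≤ b) (λ x → x ≤? b) C ×-dec (s ∈? C)

  𝒞¬ : Elt → Elt → Elt → Pred (Subset size) 0ℓ
  𝒞¬ b s t C = IsChainIn (P≤ b) C × t ∈ C × s ∉ C

  𝒞¬? : (b s t : Elt) → Decidable (𝒞¬ b s t)
  𝒞¬? b s t C = isChainIn? (P≤ b) (λ x → x ≤? b) C ×-dec (t ∈? C) ×-dec ¬? (s ∈? C)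

  -- Euler characteristic of the order complex Δ(P_{<x}):
  -- alternating count of its faces (nonempty chains of P_{<x}) by dimension.
  χΔ< : Elt → ℤ
  χΔ< x = signedSum (isChainIn? (P< x) (P<? x))

  TwoWide : Set
  TwoWide = ∀ x y z → x ≺ y → y ≺ z → ∃ λ d → d ≢ y × x ≺ d × d ≺ z

  Minimal : Elt → Set
  Minimal x = ∀ y → ¬ (y < x)

  IsParityRank : (Elt → Fin 2) → Set
  IsParityRank μ = (∀ x → Minimal x → toℕ (μ x) ≡ 0)
                 × (∀ x y → x ≺ y → toℕ (μ y) ≡ 1 ∸ toℕ (μ x))

  DownwardEulerian : (Elt → Fin 2) → Set
  DownwardEulerian μ = ∀ x → ¬ Minimal x → χΔ< x ≡ sgn (toℕ (μ x) Data.Nat.+ 1) + + 1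

-- Write S(C) = (-1)^|C| and, for a chain property R, Σ_R for the sum of S over
-- the subsets satisfying R.  Every identity comes from one bijection: adjoining
-- a top element t, C ↦ C ∪ {t}, which raises |C| by one.  Because the length of
-- C ∪ {t} is the number of elements of C, for families R' avoiding t we get
--   Σ_{C ∪ {t} : C ∈ R'} S  =  Σ_{C ∈ R'} (-1)^{#C}                    (adjoin-top)
-- and the right side is -Σ_{R'} S when the sets of R' are nonempty.
--   (1) Chains of P_{≤b} through b are the cones over the (possibly empty) chains
--       of P_{<b}, so Σ = 1 - χ(Δ(P_{<b})); then use the Euler hypothesis
--       (or χ = 0 when b is minimal) and the parity rank function.
--   (3) If a ≺ b, a chain of P_{≤b} through a is a chain of P_{≤a} through a,
--       possibly with b adjoined; the two halves cancel.
--   (2) Chains of P_{≤b} through b avoiding a are all those through b minus the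
--       cones over chains of P_{≤a} through a, so Σ = Σ_b(b) + Σ_a(a) = 0 by (1),
--       since μ(a) and μ(b) have opposite parity.
module Submission where

open import Defs
open import Data.Fin using (Fin; toℕ)
open import Data.Integer using (+_)
open import Data.Product using (_×_)
open import Relation.Binary.PropositionalEquality using (_≡_)

open import Level using (0ℓ)
open import Function using (_∘_; _⇔_; mk⇔; Equivalence)
open import Data.Nat using (ℕ; zero; suc; _∸_)
open import Data.Bool using (true; false; not)
open import Data.Fin using (zero; suc)
open import Data.Fin.Properties using (all?; _≟_)
open import Data.Fin.Subset using (Subset; _∈_; _∉_; _⊆_; Nonempty; ∣_∣; ⊥)
open import Data.Fin.Subset.Properties using (_∈?_; nonempty?; ∉⊥; ∣⊥∣≡0)
open import Data.Vec using ([]; _∷_; here; there)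
open import Data.List using (List; []; _∷_; map; filter; _++_)
open import Data.List.Properties using (map-++; map-∘)
open import Data.Integer using (ℤ; _+_; -_)
open import Data.Integer.Tactic.RingSolver using (solve-∀)
open import Data.Integer.Properties
  using (+-identityˡ; +-identityʳ; +-comm; +-assoc; +-inverseˡ; neg-distrib-+; +-commutativeSemigroup)
open import Algebra.Properties.CommutativeSemigroup +-commutativeSemigroup using (interchange)
open import Data.Product using (_,_; proj₁; proj₂)
open import Data.Sum using (_⊎_; inj₁; inj₂)
open import Data.Empty using (⊥-elim)
open import Relation.Nullary using (¬_; Dec; yes; no)
open import Relation.Nullary.Decidable using (_×-dec_; _⊎-dec_; _→-dec_; ¬?)
open import Relation.Unary using (Pred; Decidable)
open import Relation.Binary.PropositionalEquality using (_≢_; refl; sym; trans; cong; cong₂; subst)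
open import Relation.Binary.Structures using (IsDecPartialOrder)
open Relation.Binary.PropositionalEquality.≡-Reasoning

sumℤ-++ : (L M : List ℤ) → sumℤ (L ++ M) ≡ sumℤ L + sumℤ M
sumℤ-++ []      M = sym (+-identityˡ (sumℤ M))
sumℤ-++ (x ∷ L) M = trans (cong (_+_ x) (sumℤ-++ L M)) (sym (+-assoc x (sumℤ L) (sumℤ M)))

module _ {A : Set} where

  sumMap-+ : (L : List A) (g h : A → ℤ) →
             sumℤ (map (λ x → g x + h x) L) ≡ sumℤ (map g L) + sumℤ (map h L)
  sumMap-+ []      g h = refl
  sumMap-+ (x ∷ L) g h =
    trans (cong (_+_ (g x + h x)) (sumMap-+ L g h))
          (interchange (g x) (h x) (sumℤ (map g L)) (sumℤ (map h L)))

  sumMap-neg : (L : List A) (g : A → ℤ) → sumℤ (map (λ x → - g x) L) ≡ - sumℤ (map g L)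
  sumMap-neg []      g = refl
  sumMap-neg (x ∷ L) g =
    trans (cong (_+_ (- g x)) (sumMap-neg L g)) (sym (neg-distrib-+ (g x) (sumℤ (map g L))))

  sumMap-cong : (L : List A) {g h : A → ℤ} → (∀ x → g x ≡ h x) → sumℤ (map g L) ≡ sumℤ (map h L)
  sumMap-cong []      e = refl
  sumMap-cong (x ∷ L) e = cong₂ _+_ (e x) (sumMap-cong L e)

  sumMap-zero : (L : List A) (g : A → ℤ) → (∀ x → g x ≡ + 0) → sumℤ (map g L) ≡ + 0
  sumMap-zero L g e = trans (sumMap-cong L e) (zeros L)
    where
      zeros : (L : List A) → sumℤ (map (λ _ → + 0) L) ≡ + 0
      zeros []      = refl
      zeros (_ ∷ L) = trans (+-identityˡ _) (zeros L)

Σs : {n : ℕ} → (Subset n → ℤ) → ℤ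
Σs {n} g = sumℤ (map g (allSubsets n))

Σs-∷ : {n : ℕ} (g : Subset (suc n) → ℤ) →
       Σs g ≡ Σs (λ C → g (true ∷ C)) + Σs (λ C → g (false ∷ C))
Σs-∷ {n} g = begin
  sumℤ (map g (map (true ∷_) Ss ++ map (false ∷_) Ss))
    ≡⟨ cong sumℤ (map-++ g (map (true ∷_) Ss) (map (false ∷_) Ss)) ⟩
  sumℤ (map g (map (true ∷_) Ss) ++ map g (map (false ∷_) Ss))
    ≡⟨ sumℤ-++ (map g (map (true ∷_) Ss)) (map g (map (false ∷_) Ss)) ⟩
  sumℤ (map g (map (true ∷_) Ss)) + sumℤ (map g (map (false ∷_) Ss))
    ≡⟨ sym (cong₂ _+_ (cong sumℤ (map-∘ Ss)) (cong sumℤ (map-∘ Ss))) ⟩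
  Σs (λ C → g (true ∷ C)) + Σs (λ C → g (false ∷ C)) ∎
  where Ss = allSubsets n

toggle : {n : ℕ} → Fin n → Subset n → Subset n
toggle zero    (x ∷ C) = not x ∷ C
toggle (suc i) (x ∷ C) = x ∷ toggle i C

Σs-toggle : {n : ℕ} (i : Fin n) (g : Subset n → ℤ) → Σs (g ∘ toggle i) ≡ Σs g
Σs-toggle zero g = begin
  Σs (g ∘ toggle zero)                                ≡⟨ Σs-∷ (g ∘ toggle zero) ⟩
  Σs (λ C → g (false ∷ C)) + Σs (λ C → g (true ∷ C))  ≡⟨ +-comm (Σs (λ C → g (false ∷ C))) _ ⟩
  Σs (λ C → g (true ∷ C)) + Σs (λ C → g (false ∷ C))  ≡⟨ sym (Σs-∷ g) ⟩
  Σs g                                                ∎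
Σs-toggle (suc i) g = begin
  Σs (g ∘ toggle (suc i))
    ≡⟨ Σs-∷ (g ∘ toggle (suc i)) ⟩
  Σs (λ C → g (true ∷ toggle i C)) + Σs (λ C → g (false ∷ toggle i C))
    ≡⟨ cong₂ _+_ (Σs-toggle i (λ C → g (true ∷ C))) (Σs-toggle i (λ C → g (false ∷ C))) ⟩
  Σs (λ C → g (true ∷ C)) + Σs (λ C → g (false ∷ C))
    ≡⟨ sym (Σs-∷ g) ⟩
  Σs g ∎

Σs-at-⊥ : {n : ℕ} (g : Subset n → ℤ) → (∀ C → Nonempty C → g C ≡ + 0) → Σs g ≡ g ⊥
Σs-at-⊥ {zero}  g _      = +-identityʳ (g [])
Σs-at-⊥ {suc n} g vanish = begin
  Σs g                                                ≡⟨ Σs-∷ g ⟩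
  Σs (λ C → g (true ∷ C)) + Σs (λ C → g (false ∷ C))
    ≡⟨ cong₂ _+_ (sumMap-zero (allSubsets n) _ (λ C → vanish (true ∷ C) (zero , here)))
                 (Σs-at-⊥ (λ C → g (false ∷ C)) (λ { C (x , x∈C) → vanish (false ∷ C) (suc x , there x∈C) })) ⟩
  + 0 + g ⊥                                           ≡⟨ +-identityˡ (g ⊥) ⟩
  g ⊥                                                 ∎

toggle-adds : {n : ℕ} (t : Fin n) (C : Subset n) → t ∉ C → t ∈ toggle t C
toggle-adds zero    (true ∷ C)  t∉C = ⊥-elim (t∉C here)
toggle-adds zero    (false ∷ C) _   = here
toggle-adds (suc t) (_ ∷ C)     t∉C = there (toggle-adds t C (t∉C ∘ there))

toggle-removes : {n : ℕ} (t : Fin n) (C : Subset n) → t ∈ C → t ∉ toggle t C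
toggle-removes zero    (true ∷ C)  _         ()
toggle-removes (suc t) (_ ∷ C)     (there p) (there q) = toggle-removes t C p q

toggle-keeps : {n : ℕ} (t y : Fin n) (C : Subset n) → y ≢ t → y ∈ toggle t C ⇔ y ∈ C
toggle-keeps t y C y≢t = mk⇔ (to t y C y≢t) (from t y C y≢t)
  where
    to : ∀ {n} (t y : Fin n) (C : Subset n) → y ≢ t → y ∈ toggle t C → y ∈ C
    to zero    zero    _       y≢t _         = ⊥-elim (y≢t refl)
    to zero    (suc y) (_ ∷ C) _   (there p) = there p
    to (suc t) zero    (_ ∷ C) _   here      = here
    to (suc t) (suc y) (_ ∷ C) y≢t (there p) = there (to t y C (y≢t ∘ cong suc) p)
    from : ∀ {n} (t y : Fin n) (C : Subset n) → y ≢ t → y ∈ C → y ∈ toggle t C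
    from zero    zero    _       y≢t _         = ⊥-elim (y≢t refl)
    from zero    (suc y) (_ ∷ C) _   (there p) = there p
    from (suc t) zero    (_ ∷ C) _   here      = here
    from (suc t) (suc y) (_ ∷ C) y≢t (there p) = there (from t y C (y≢t ∘ cong suc) p)

∣toggle∣ : {n : ℕ} (t : Fin n) (C : Subset n) → t ∉ C → ∣ toggle t C ∣ ≡ suc ∣ C ∣
∣toggle∣ zero    (true ∷ C)  t∉C = ⊥-elim (t∉C here)
∣toggle∣ zero    (false ∷ C) _   = refl
∣toggle∣ (suc t) (true ∷ C)  t∉C = cong suc (∣toggle∣ t C (t∉C ∘ there))
∣toggle∣ (suc t) (false ∷ C) t∉C = ∣toggle∣ t C (t∉C ∘ there)

-- (-1)^{|C|}, with |C| the chain length #C - 1 (truncated at 0), and (-1)^{#C}.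
lengthSign : {n : ℕ} → Subset n → ℤ
lengthSign C = sgn (∣ C ∣ ∸ 1)

sizeSign : {n : ℕ} → Subset n → ℤ
sizeSign C = sgn ∣ C ∣

sgn-nonempty : {n : ℕ} (C : Subset n) → Nonempty C → sizeSign C ≡ - lengthSign C
sgn-nonempty (true ∷ C)  _                 = refl
sgn-nonempty (false ∷ C) (zero , ())
sgn-nonempty (false ∷ C) (suc x , there p) = sgn-nonempty C (x , p)

ind : {A : Set} → Dec A → ℤ → ℤ
ind (yes _) x = x
ind (no _)  _ = + 0

ind-no : {A : Set} (d : Dec A) → ¬ A → (x : ℤ) → ind d x ≡ + 0
ind-no (yes a) ¬a _ = ⊥-elim (¬a a)
ind-no (no _)  _  _ = refl

ind-cong : {A B : Set} (d : Dec A) (e : Dec B) {x y : ℤ} → A ⇔ B → (A → x ≡ y) → ind d x ≡ ind e y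
ind-cong (yes a) (yes _) _   x≡y = x≡y a
ind-cong (yes a) (no ¬b) A⇔B _   = ⊥-elim (¬b (Equivalence.to A⇔B a))
ind-cong (no ¬a) (yes b) A⇔B _   = ⊥-elim (¬a (Equivalence.from A⇔B b))
ind-cong (no _)  (no _)  _   _   = refl

ind-split : {A B : Set} (d : Dec A) (e : Dec B) (x : ℤ) →
            ind d x ≡ ind (d ×-dec e) x + ind (d ×-dec ¬? e) x
ind-split (yes _) (yes _) x = sym (+-identityʳ x)
ind-split (yes _) (no _)  x = sym (+-identityˡ x)
ind-split (no _)  _       x = refl

module _ {n : ℕ} where

  sumOver : {R : Pred (Subset n) 0ℓ} → Decidable R → (Subset n → ℤ) → ℤ
  sumOver R? w = Σs (λ C → ind (R? C) (w C))

  sumFilter : {R : Pred (Subset n) 0ℓ} (R? : Decidable R) (w : Subset n → ℤ) →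
              sumℤ (map w (filter R? (allSubsets n))) ≡ sumOver R? w
  sumFilter R? w = go (allSubsets n)
    where
      go : (L : List (Subset n)) → sumℤ (map w (filter R? L)) ≡ sumℤ (map (λ C → ind (R? C) (w C)) L)
      go []      = refl
      go (C ∷ L) with R? C
      ... | yes _ = cong (_+_ (w C)) (go L)
      ... | no  _ = trans (go L) (sym (+-identityˡ _))

  sumOver-⇔ : {R R' : Pred (Subset n) 0ℓ} (R? : Decidable R) (R'? : Decidable R') (w : Subset n → ℤ) →
              (∀ C → R C ⇔ R' C) → sumOver R? w ≡ sumOver R'? w
  sumOver-⇔ R? R'? w R⇔R' = sumMap-cong (allSubsets n) (λ C → ind-cong (R? C) (R'? C) (R⇔R' C) (λ _ → refl))

  sumOver-split : {R D : Pred (Subset n) 0ℓ} (R? : Decidable R) (D? : Decidable D) (w : Subset n → ℤ) →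
                  sumOver R? w ≡ sumOver (λ C → R? C ×-dec D? C) w + sumOver (λ C → R? C ×-dec ¬? (D? C)) w
  sumOver-split R? D? w =
    trans (sumMap-cong (allSubsets n) (λ C → ind-split (R? C) (D? C) (w C))) (sumMap-+ (allSubsets n) _ _)

  sumOver-empty : {R : Pred (Subset n) 0ℓ} (R? : Decidable R) (w : Subset n → ℤ) →
                  (∀ C → ¬ R C) → sumOver R? w ≡ + 0
  sumOver-empty R? w none = sumMap-zero (allSubsets n) _ (λ C → ind-no (R? C) (none C) (w C))

  sumOver-neg : {R : Pred (Subset n) 0ℓ} (R? : Decidable R) (w w' : Subset n → ℤ) →
                (∀ C → R C → w' C ≡ - w C) → sumOver R? w' ≡ - sumOver R? w
  sumOver-neg R? w w' flip = begin
    sumOver R? w'                          ≡⟨ sumMap-cong (allSubsets n) (λ C → neg-ind (R? C) (flip C)) ⟩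
    Σs (λ C → - ind (R? C) (w C))          ≡⟨ sumMap-neg (allSubsets n) _ ⟩
    - sumOver R? w                         ∎
    where
      neg-ind : {A : Set} (d : Dec A) {x y : ℤ} → (A → y ≡ - x) → ind d y ≡ - ind d x
      neg-ind (yes a) y≡-x = y≡-x a
      neg-ind (no _)  _    = refl

  sumOver-only-⊥ : {R : Pred (Subset n) 0ℓ} (R? : Decidable R) (w : Subset n → ℤ) →
                   (∀ C → R C → ¬ Nonempty C) → R ⊥ → sumOver R? w ≡ w ⊥
  sumOver-only-⊥ R? w empty R⊥ = trans
    (Σs-at-⊥ (λ C → ind (R? C) (w C)) (λ C ne → ind-no (R? C) (λ RC → empty C RC ne) (w C)))
    (ind-cong (R? ⊥) (yes R⊥) (mk⇔ (λ r → r) (λ r → r)) (λ _ → refl))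

  -- Adjoining a top element t.
  adjoin-top : {R R' : Pred (Subset n) 0ℓ} (R? : Decidable R) (R'? : Decidable R') (t : Fin n) →
               (∀ C → R C → t ∈ C) → (∀ C → R' C → t ∉ C) →
               (∀ C → t ∉ C → R (toggle t C) ⇔ R' C) →
               sumOver R? lengthSign ≡ sumOver R'? sizeSign
  adjoin-top R? R'? t R∋t R'∌t cone =
    trans (sym (Σs-toggle t _)) (sumMap-cong (allSubsets n) termwise)
    where
      termwise : ∀ C → ind (R? (toggle t C)) (lengthSign (toggle t C)) ≡ ind (R'? C) (sizeSign C)
      termwise C with t ∈? C
      ... | yes t∈C = ind-cong (R? (toggle t C)) (R'? C)
                        (mk⇔ (λ r → ⊥-elim (toggle-removes t C t∈C (R∋t _ r)))
                             (λ r' → ⊥-elim (R'∌t C r' t∈C)))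
                        (λ r → ⊥-elim (toggle-removes t C t∈C (R∋t _ r)))
      ... | no  t∉C = ind-cong (R? (toggle t C)) (R'? C) (cone C t∉C)
                        (λ _ → cong (λ k → sgn (k ∸ 1)) (∣toggle∣ t C t∉C))

  sumOver-nonempty : {R : Pred (Subset n) 0ℓ} (R? : Decidable R) → (∀ C → R C → Nonempty C) →
                     sumOver R? sizeSign ≡ - sumOver R? lengthSign
  sumOver-nonempty R? nonempty = sumOver-neg R? _ _ (λ C r → sgn-nonempty C (nonempty C r))

-- Chains in a finite poset.

module Chains (P : FinPoset) where
  open FinPoset P
  open IsDecPartialOrder isDecPartialOrder
    using () renaming (reflexive to ≤-reflexive; trans to ≤-trans; antisym to ≤-antisym)

  -- Possibly empty chains inside Q; IsChainIn P Q C unfolds to Nonempty C × IsChain Q C.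
  IsChain : Pred (Elt P) 0ℓ → Subset size → Set
  IsChain Q C = (∀ x → x ∈ C → Q x) × (∀ x y → x ∈ C → y ∈ C → x ≤ y ⊎ y ≤ x)

  isChain? : (Q : Pred (Elt P) 0ℓ) → Decidable Q → Decidable (IsChain Q)
  isChain? Q Q? C =
    all? (λ x → (x ∈? C) →-dec Q? x)
    ×-dec all? (λ x → all? (λ y → (x ∈? C) →-dec (y ∈? C) →-dec ((x ≤? y) ⊎-dec (y ≤? x))))

  signedSum≡sumOver : {R : Pred (Subset size) 0ℓ} (R? : Decidable R) →
                      signedSum P R? ≡ sumOver R? lengthSign
  signedSum≡sumOver R? = sumFilter R? lengthSign

  Σ𝒞 : Elt P → ℤ
  Σ𝒞 x = signedSum P (𝒞? P x x)

  IsChain-mono : {Q : Pred (Elt P) 0ℓ} {C D : Subset size} → C ⊆ D → IsChain Q D → IsChain Q C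
  IsChain-mono C⊆D (inQ , comparable) =
    (λ x x∈C → inQ x (C⊆D x∈C)) , (λ x y x∈C y∈C → comparable x y (C⊆D x∈C) (C⊆D y∈C))

  IsChain-weaken : {Q Q' : Pred (Elt P) 0ℓ} {C : Subset size} → (∀ x → Q x → Q' x) → IsChain Q C → IsChain Q' C
  IsChain-weaken Q⇒Q' (inQ , comparable) = (λ x x∈C → Q⇒Q' x (inQ x x∈C)) , comparable

  below-top : (b : Elt P) (C : Subset size) → b ∉ C → IsChain (P≤ P b) C ⇔ IsChain (P< P b) C
  below-top b C b∉C = mk⇔
    (λ (inQ , comparable) → (λ x x∈C → inQ x x∈C , λ x≡b → b∉C (subst (_∈ C) x≡b x∈C)) , comparable)
    (IsChain-weaken (λ _ → proj₁))

  cone : (b : Elt P) (C : Subset size) → b ∉ C → IsChain (P≤ P b) (toggle b C) ⇔ IsChain (P< P b) C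
  cone b C b∉C = mk⇔
    (λ ch → Equivalence.to (below-top b C b∉C) (IsChain-mono (λ {x} → grow x) ch))
    (λ ch → let (inQ , comparable) = Equivalence.from (below-top b C b∉C) ch in conify inQ comparable)
    where
      grow : ∀ x → x ∈ C → x ∈ toggle b C
      grow x x∈C = Equivalence.from (toggle-keeps b x C (λ x≡b → b∉C (subst (_∈ C) x≡b x∈C))) x∈C
      split : ∀ x → x ∈ toggle b C → x ≡ b ⊎ x ∈ C
      split x x∈ with x ≟ b
      ... | yes x≡b = inj₁ x≡b
      ... | no  x≢b = inj₂ (Equivalence.to (toggle-keeps b x C x≢b) x∈)
      conify : (∀ x → x ∈ C → x ≤ b) → (∀ x y → x ∈ C → y ∈ C → x ≤ y ⊎ y ≤ x) →
               IsChain (P≤ P b) (toggle b C)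
      conify inQ comparable = below , comp
        where
          below : ∀ x → x ∈ toggle b C → x ≤ b
          below x x∈ with split x x∈
          ... | inj₁ x≡b = ≤-reflexive x≡b
          ... | inj₂ x∈C = inQ x x∈C
          comp : ∀ x y → x ∈ toggle b C → y ∈ toggle b C → x ≤ y ⊎ y ≤ x
          comp x y x∈ y∈ with split x x∈ | split y y∈
          ... | inj₁ refl | _         = inj₂ (below y y∈)
          ... | inj₂ _    | inj₁ refl = inj₁ (below x x∈)
          ... | inj₂ x∈C  | inj₂ y∈C  = comparable x y x∈C y∈C

  -- Part (1) before the Euler hypothesis: Σ𝒞 b = 1 - χ(Δ(P_{<b})), the 1 coming
  -- from the cone over the empty chain, i.e. the chain {b}.
  Σ𝒞≡1-χ : (b : Elt P) → Σ𝒞 b ≡ - χΔ< P b + + 1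
  Σ𝒞≡1-χ b = begin
    Σ𝒞 b
      ≡⟨ signedSum≡sumOver (𝒞? P b b) ⟩
    sumOver (𝒞? P b b) lengthSign
      ≡⟨ adjoin-top (𝒞? P b b) Chain<? b (λ _ → proj₂) (λ C ch b∈C → proj₂ (proj₁ ch b b∈C) refl) cone-over-b ⟩
    sumOver Chain<? sizeSign
      ≡⟨ sumOver-split Chain<? nonempty? _ ⟩
    sumOver (λ C → Chain<? C ×-dec nonempty? C) sizeSign
      + sumOver (λ C → Chain<? C ×-dec ¬? (nonempty? C)) sizeSign
      ≡⟨ cong₂ _+_ nonempty-part empty-part ⟩
    - χΔ< P b + + 1 ∎
    where
      Chain<? : Decidable (IsChain (P< P b))
      Chain<? = isChain? (P< P b) (P<? P b)
      χ? : Decidable (IsChainIn P (P< P b))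
      χ? = isChainIn? P (P< P b) (P<? P b)
      ⊥-is-chain : IsChain (P< P b) ⊥
      ⊥-is-chain = (λ _ x∈⊥ → ⊥-elim (∉⊥ x∈⊥)) , (λ _ _ x∈⊥ _ → ⊥-elim (∉⊥ x∈⊥))
      cone-over-b : ∀ C → b ∉ C → 𝒞 P b b (toggle b C) ⇔ IsChain (P< P b) C
      cone-over-b C b∉C = mk⇔
        (λ ((_ , ch) , _) → Equivalence.to (cone b C b∉C) ch)
        (λ ch → ((b , toggle-adds b C b∉C) , Equivalence.from (cone b C b∉C) ch) , toggle-adds b C b∉C)
      empty-part : sumOver (λ C → Chain<? C ×-dec ¬? (nonempty? C)) sizeSign ≡ + 1
      empty-part = trans
        (sumOver-only-⊥ (λ C → Chain<? C ×-dec ¬? (nonempty? C)) sizeSign (λ _ → proj₂)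
                        (⊥-is-chain , ∉⊥ ∘ proj₂))
        (cong sgn (∣⊥∣≡0 size))
      nonempty-part : sumOver (λ C → Chain<? C ×-dec nonempty? C) sizeSign ≡ - χΔ< P b
      nonempty-part = begin
        sumOver (λ C → Chain<? C ×-dec nonempty? C) sizeSign
          ≡⟨ sumOver-⇔ _ χ? _ (λ C → mk⇔ (λ (ch , ne) → ne , ch) (λ (ne , ch) → ch , ne)) ⟩
        sumOver χ? sizeSign
          ≡⟨ sumOver-nonempty χ? (λ _ → proj₁) ⟩
        - sumOver χ? lengthSign
          ≡⟨ cong -_ (sym (signedSum≡sumOver χ?)) ⟩
        - χΔ< P b ∎

  χΔ<-minimal : (x : Elt P) → Minimal P x → χΔ< P x ≡ + 0
  χΔ<-minimal x min = trans (signedSum≡sumOver χ?)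
    (sumOver-empty χ? _ (λ { C ((y , y∈C) , inQ , _) → min y (inQ y y∈C) }))
    where
      χ? : Decidable (IsChainIn P (P< P x))
      χ? = isChainIn? P (P< P x) (P<? P x)

  module Cover (a b : Elt P) (a≺b : _≺_ P a b) where

    a≤b : a ≤ b
    a≤b = proj₁ (proj₁ a≺b)

    b≰a : ¬ (b ≤ a)
    b≰a b≤a = proj₂ (proj₁ a≺b) (≤-antisym a≤b b≤a)

    covered : (C : Subset size) → a ∈ C → IsChain (P< P b) C ⇔ IsChain (P≤ P a) C
    covered C a∈C = mk⇔
      (λ (inQ , comparable) → (λ x x∈C → under x (inQ x x∈C) (comparable x a x∈C a∈C)) , comparable)
      (IsChain-weaken (λ x x≤a → ≤-trans x≤a a≤b , λ x≡b → b≰a (subst (_≤ a) x≡b x≤a)))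
      where
        under : ∀ x → P< P b x → x ≤ a ⊎ a ≤ x → x ≤ a
        under x _   (inj₁ x≤a) = x≤a
        under x x<b (inj₂ a≤x) with a ≟ x
        ... | yes a≡x = ≤-reflexive (sym a≡x)
        ... | no  a≢x = ⊥-elim (proj₂ a≺b x ((a≤x , a≢x) , x<b))

    Top? : Decidable (λ C → 𝒞 P b a C × b ∈ C)
    Top? C = 𝒞? P b a C ×-dec (b ∈? C)

    -- They are the cones over chains of P_{≤a} through a, so they sum to -Σ𝒞 a.
    Σ-through-both : sumOver Top? lengthSign ≡ - Σ𝒞 a
    Σ-through-both = begin
      sumOver Top? lengthSign
        ≡⟨ adjoin-top Top? (𝒞? P a a) b (λ _ → proj₂) (λ C 𝒞a b∈C → b≰a (proj₁ (proj₂ (proj₁ 𝒞a)) b b∈C)) cone-over-a ⟩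
      sumOver (𝒞? P a a) sizeSign
        ≡⟨ sumOver-nonempty (𝒞? P a a) (λ C → proj₁ ∘ proj₁) ⟩
      - sumOver (𝒞? P a a) lengthSign
        ≡⟨ cong -_ (sym (signedSum≡sumOver (𝒞? P a a))) ⟩
      - Σ𝒞 a ∎
      where
        cone-over-a : ∀ C → b ∉ C → (𝒞 P b a (toggle b C) × b ∈ toggle b C) ⇔ 𝒞 P a a C
        cone-over-a C b∉C = mk⇔
          (λ (((_ , ch) , a∈) , _) →
            let a∈C = Equivalence.to a-kept a∈ in
            ((a , a∈C) , Equivalence.to (covered C a∈C) (Equivalence.to (cone b C b∉C) ch)) , a∈C)
          (λ ((_ , ch) , a∈C) →
            (((b , toggle-adds b C b∉C) , Equivalence.from (cone b C b∉C) (Equivalence.from (covered C a∈C) ch))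
              , Equivalence.from a-kept a∈C) , toggle-adds b C b∉C)
          where
            a-kept : a ∈ toggle b C ⇔ a ∈ C
            a-kept = toggle-keeps b a C (proj₂ (proj₁ a≺b))

    Σ-through-a-only : sumOver (λ C → 𝒞? P b a C ×-dec ¬? (b ∈? C)) lengthSign ≡ Σ𝒞 a
    Σ-through-a-only = trans (sumOver-⇔ _ (𝒞? P a a) _ equiv) (sym (signedSum≡sumOver (𝒞? P a a)))
      where
        equiv : ∀ C → (𝒞 P b a C × b ∉ C) ⇔ 𝒞 P a a C
        equiv C = mk⇔
          (λ (((ne , ch) , a∈C) , b∉C) →
            (ne , Equivalence.to (covered C a∈C) (Equivalence.to (below-top b C b∉C) ch)) , a∈C)
          (λ ((ne , ch) , a∈C) →
            let chb = Equivalence.from (covered C a∈C) ch in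
            ((ne , Equivalence.from (below-top b C (λ b∈C → proj₂ (proj₁ chb b b∈C) refl)) chb) , a∈C)
              , (λ b∈C → b≰a (proj₁ ch b b∈C)))

    -- Part (3): the chains through a with and without b cancel.
    Σ-through-a : signedSum P (𝒞? P b a) ≡ + 0
    Σ-through-a = begin
      signedSum P (𝒞? P b a)                 ≡⟨ signedSum≡sumOver (𝒞? P b a) ⟩
      sumOver (𝒞? P b a) lengthSign          ≡⟨ sumOver-split (𝒞? P b a) (b ∈?_) lengthSign ⟩
      sumOver Top? lengthSign + sumOver (λ C → 𝒞? P b a C ×-dec ¬? (b ∈? C)) lengthSign
                                             ≡⟨ cong₂ _+_ Σ-through-both Σ-through-a-only ⟩
      - Σ𝒞 a + Σ𝒞 a                          ≡⟨ +-inverseˡ (Σ𝒞 a) ⟩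
      + 0                                    ∎

    -- Chains of P_{≤b} through b split by whether they contain a; those that do
    -- are cones over chains through a, so avoiding a gives Σ𝒞 b + Σ𝒞 a.
    Σ-avoiding-a : signedSum P (𝒞¬? P b a b) ≡ Σ𝒞 b + Σ𝒞 a
    Σ-avoiding-a = begin
      signedSum P (𝒞¬? P b a b)              ≡⟨ move (Σ𝒞 a) _ ⟩
      - Σ𝒞 a + signedSum P (𝒞¬? P b a b) + Σ𝒞 a
                                             ≡⟨ cong (_+ Σ𝒞 a) (sym through-b) ⟩
      Σ𝒞 b + Σ𝒞 a                            ∎
      where
        move : ∀ x y → y ≡ - x + y + x
        move = solve-∀
        through-b : Σ𝒞 b ≡ - Σ𝒞 a + signedSum P (𝒞¬? P b a b)
        through-b = begin
          Σ𝒞 b                                  ≡⟨ signedSum≡sumOver (𝒞? P b b) ⟩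
          sumOver (𝒞? P b b) lengthSign         ≡⟨ sumOver-split (𝒞? P b b) (a ∈?_) lengthSign ⟩
          sumOver (λ C → 𝒞? P b b C ×-dec (a ∈? C)) lengthSign
            + sumOver (λ C → 𝒞? P b b C ×-dec ¬? (a ∈? C)) lengthSign
            ≡⟨ cong₂ _+_ (sumOver-⇔ _ Top? lengthSign (λ C → mk⇔ reorder reorder))
                         (sumOver-⇔ _ (𝒞¬? P b a b) lengthSign
                            (λ C → mk⇔ (λ ((ch , b∈) , a∉) → ch , b∈ , a∉) (λ (ch , b∈ , a∉) → (ch , b∈) , a∉))) ⟩
          sumOver Top? lengthSign + sumOver (𝒞¬? P b a b) lengthSign
            ≡⟨ cong₂ _+_ Σ-through-both (sym (signedSum≡sumOver (𝒞¬? P b a b))) ⟩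
          - Σ𝒞 a + signedSum P (𝒞¬? P b a b)     ∎
          where
            reorder : ∀ {C} {s t : Elt P} → (IsChainIn P (P≤ P b) C × s ∈ C) × t ∈ C → (IsChainIn P (P≤ P b) C × t ∈ C) × s ∈ C
            reorder ((ch , s∈) , t∈) = (ch , t∈) , s∈

euler-sign : (m : Fin 2) → - (sgn (toℕ m Data.Nat.+ 1) + + 1) + + 1 ≡ sgn (toℕ m)
euler-sign zero       = refl
euler-sign (suc zero) = refl

opposite-signs : (m m' : Fin 2) → toℕ m' ≡ 1 ∸ toℕ m → sgn (toℕ m') + sgn (toℕ m) ≡ + 0
opposite-signs zero       (suc zero) _ = refl
opposite-signs (suc zero) zero       _ = refl
opposite-signs zero       zero       ()
opposite-signs (suc zero) (suc zero) ()

Σ𝒞-parity : (P : FinPoset) (μ : Elt P → Fin 2) → IsParityRank P μ → DownwardEulerian P μ →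
            (x : Elt P) → Chains.Σ𝒞 P x ≡ sgn (toℕ (μ x))
Σ𝒞-parity P μ (μ-minimal , _) eulerian x with all? (λ y → ¬? (P<? P x y))
... | yes minimal = begin
  Σ𝒞 x                ≡⟨ Σ𝒞≡1-χ x ⟩
  - χΔ< P x + + 1     ≡⟨ cong (λ χ → - χ + + 1) (χΔ<-minimal x minimal) ⟩
  + 1                 ≡⟨ cong sgn (sym (μ-minimal x minimal)) ⟩
  sgn (toℕ (μ x))     ∎
  where open Chains P
... | no non-minimal = begin
  Σ𝒞 x                                         ≡⟨ Σ𝒞≡1-χ x ⟩
  - χΔ< P x + + 1                              ≡⟨ cong (λ χ → - χ + + 1) (eulerian x non-minimal) ⟩
  - (sgn (toℕ (μ x) Data.Nat.+ 1) + + 1) + + 1 ≡⟨ euler-sign (μ x) ⟩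
  sgn (toℕ (μ x))                              ∎
  where open Chains P

lemma2p2 : (P : FinPoset) → TwoWide P → (μ : Elt P → Fin 2) → IsParityRank P μ
    → DownwardEulerian P μ → (a b : Elt P)
    → (signedSum P (𝒞? P b b) ≡ sgn (toℕ (μ b)))
      × (_≺_ P a b → signedSum P (𝒞¬? P b a b) ≡ + 0)
      × (_≺_ P a b → signedSum P (𝒞? P b a) ≡ + 0)
lemma2p2 P _ μ parity eulerian a b = part1 , part2 , part3
  where
    part1 : Chains.Σ𝒞 P b ≡ sgn (toℕ (μ b))
    part1 = Σ𝒞-parity P μ parity eulerian b

    part2 : _≺_ P a b → signedSum P (𝒞¬? P b a b) ≡ + 0
    part2 a≺b = begin
      signedSum P (𝒞¬? P b a b)          ≡⟨ Chains.Cover.Σ-avoiding-a P a b a≺b ⟩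
      Chains.Σ𝒞 P b + Chains.Σ𝒞 P a      ≡⟨ cong₂ _+_ part1 (Σ𝒞-parity P μ parity eulerian a) ⟩
      sgn (toℕ (μ b)) + sgn (toℕ (μ a))  ≡⟨ opposite-signs (μ a) (μ b) (proj₂ parity a b a≺b) ⟩
      + 0                                ∎

    part3 : _≺_ P a b → signedSum P (𝒞? P b a) ≡ + 0
    part3 = Chains.Cover.Σ-through-a P a b
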